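{- Let $\lambda X$ be a pure type system with specification $(\mathcal S,\mathcal A,\mathcal R)$. Suppose there are $n\in\mathbb N$ with $n>1$ and sorts $s_1,\dots,s_n\in\mathcal S$ such that $s_1=s_n\in\mathcal N$ and for each $1\le i<n$ there is $s'\in\mathcal I$ with $(s',s_i,s_{i+1})\in\mathcal R$; and suppose moreover that for all $(s_1',s_2',s_3')\in\mathcal R$ we have $(s_1:s_2')\notin\mathcal A$. Then there is no Hilbert-style pure type system equivalent to $\lambda X$.
   Context: Pure type systems (PTS). A PTS has an infinite set $V$ of variables, a set $\mathcal C$ of constants, a set of sorts $\mathcal S\subseteq\mathcal C$, axioms $\mathcal A$ of the form $c:s$ ($c\in\mathcal C,s\in\mathcal S$) and rules $\mathcal R\subseteq\mathcal S^3$. Pseudoterms: $\mathcal T::=V\mid\mathcal C\mid\Pi V{:}\mathcal T.\mathcal T\mid\lambda V{:}\mathcal T.\mathcal T\mid\mathcal T\mathcal T$. Judgements $\Gamma\vdash M:A$ with $\Gamma$ a finite sequence of declarations $x:A$. Rules: (axiom) $\vdash c:s$ for $(c:s)\in\mathcal A$; (start) from $\Gamma\vdash A:s$ infer $\Gamma,x:A\vdash x:A$ ($x$ fresh); (weakening) from $\Gamma\vdash M:B$ and $\Gamma\vdash A:s$ infer $\Gamma,x:A\vdash M:B$ ($x$ fresh); (application) from $\Gamma\vdash M:(\Pi x{:}A.B)$ and $\Gamma\vdash N:A$ infer $\Gamma\vdash MN:B[x:=N]$; (abstraction) from $\Gamma,x:A\vdash M:B$ and $\Gamma\vdash(\Pi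 x{:}A.B):s$ infer $\Gamma\vdash(\lambda x{:}A.M):(\Pi x{:}A.B)$; (product) from $\Gamma,x:A\vdash B:s_2$, $\Gamma\vdash A:s_1$, $(s_1,s_2,s_3)\in\mathcal R$ infer $\Gamma\vdash(\Pi x{:}A.B):s_3$; (conversion) from $\Gamma\vdash M:A$, $\Gamma\vdash B:s$, $A=_\beta B$ infer $\Gamma\vdash M:B$ (here $s,s_i$ range over $\mathcal S$). A sort $s$ is inhabited ($s\in\mathcal I$) if $\vdash A:s$ is derivable for some $A$; it is normal form inhabited ($s\in\mathcal N$) if $\vdash A:s$ for some $A$ in $\beta$-normal form. Hilbert-style PTS (HPTS): same $V,\mathcal C,\mathcal S,\mathcal T$, only empty contexts, axioms $\mathcal A$ plus a finite set $\mathcal B$ of axiom schemes (judgements $\vdash M:A$ whose sort variables may be instantiated by sorts); rules: the axioms, (application) and (conversion) with empty contexts, (type reduction) from $\vdash M:A$ and $A\to_\beta B$ infer $\vdash M:B$, and (subject reduction) from $\vdash M:A$ and $M\to_\beta N$ infer $\vdash N:A$. An HPTS with specification $(\mathcal S,\mathcal A,\mathcal B)$ is equivalent to the PTS $(\mathcal S,\mathcal A,\mathcal R)$ if for all $M,A$: $\vdash M:A$ is derivable in the PTS iff it is derivable in the HPTS. -}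

module Defs where

open import Data.Nat using (ℕ; zero; suc; _<_; _≤_)
open import Data.Fin using (Fin)
open import Data.Sum using (_⊎_; [_,_])
open import Data.List using (List; []; _∷_)
open import Data.List.Membership.Propositional using (_∈_)
open import Data.Product using (Σ; ∃; _×_)
open import Function using (id)
open import Relation.Nullary using (¬_)
open import Relation.Binary.PropositionalEquality using (_≡_)
open import Relation.Binary.Construct.Closure.Equivalence using (EqClosure)

-- Pseudoterms over a set X of constants, variables as de Bruijn indices
-- (V = ℕ; terms are taken modulo α-conversion).

data Tm (X : Set) : Set where
  var   : ℕ → Tm X
  const : X → Tm X
  Pi    : Tm X → Tm X → Tm X      -- Pi A B  =  Π x:A. B   (B under one binder)
  lam   : Tm X → Tm X → Tm X      -- lam A M =  λ x:A. M   (M under one binder)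
  app   : Tm X → Tm X → Tm X

module _ {X : Set} where

  extR : (ℕ → ℕ) → ℕ → ℕ
  extR ρ zero    = zero
  extR ρ (suc i) = suc (ρ i)

  rename : (ℕ → ℕ) → Tm X → Tm X
  rename ρ (var i)   = var (ρ i)
  rename ρ (const c) = const c
  rename ρ (Pi A B)  = Pi (rename ρ A) (rename (extR ρ) B)
  rename ρ (lam A M) = lam (rename ρ A) (rename (extR ρ) M)
  rename ρ (app M N) = app (rename ρ M) (rename ρ N)

  shift : Tm X → Tm X
  shift = rename suc

  extS : (ℕ → Tm X) → ℕ → Tm X
  extS σ zero    = var zero
  extS σ (suc i) = shift (σ i)

  subst : (ℕ → Tm X) → Tm X → Tm X
  subst σ (var i)   = σ i
  subst σ (const c) = const c
  subst σ (Pi A B)  = Pi (subst σ A) (subst (extS σ) B)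
  subst σ (lam A M) = lam (subst σ A) (subst (extS σ) M)
  subst σ (app M N) = app (subst σ M) (subst σ N)

  single : Tm X → ℕ → Tm X
  single N zero    = N
  single N (suc i) = var i

  _[_] : Tm X → Tm X → Tm X
  B [ N ] = subst (single N) B

  infix 4 _⟶β_
  data _⟶β_ : Tm X → Tm X → Set where
    beta  : ∀ {A M N} → app (lam A M) N ⟶β (M [ N ])
    piL   : ∀ {A A' B} → A ⟶β A' → Pi A B ⟶β Pi A' B
    piR   : ∀ {A B B'} → B ⟶β B' → Pi A B ⟶β Pi A B'
    lamL  : ∀ {A A' M} → A ⟶β A' → lam A M ⟶β lam A' M
    lamR  : ∀ {A M M'} → M ⟶β M' → lam A M ⟶β lam A M'
    appL  : ∀ {M M' N} → M ⟶β M' → app M N ⟶β app M' N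
    appR  : ∀ {M N N'} → N ⟶β N' → app M N ⟶β app M N'

  infix 4 _=β_
  _=β_ : Tm X → Tm X → Set
  _=β_ = EqClosure _⟶β_

  NormalForm : Tm X → Set
  NormalForm M = ∀ N → ¬ (M ⟶β N)

  mapC : {Y : Set} → (X → Y) → Tm X → Tm Y
  mapC f (var i)   = var i
  mapC f (const c) = const (f c)
  mapC f (Pi A B)  = Pi (mapC f A) (mapC f B)
  mapC f (lam A M) = lam (mapC f A) (mapC f M)
  mapC f (app M N) = app (mapC f M) (mapC f N)

-- PTS specification (S, A, R) over a set of constants C, with S ⊆ C.

record Spec : Set₁ where
  field
    Const  : Set
    Sort   : Const → Set
    Ax     : Const → Const → Set
    Rule   : Const → Const → Const → Set
    Ax-sort   : ∀ {c s} → Ax c s → Sort s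
    Rule-sort : ∀ {s₁ s₂ s₃} → Rule s₁ s₂ s₃ → Sort s₁ × Sort s₂ × Sort s₃

module PTS (P : Spec) where
  open Spec P

  Term : Set
  Term = Tm Const

  Ctx : Set
  Ctx = List Term     -- head = most recently declared variable (index 0)

  infix 3 _⊢_∶_
  data _⊢_∶_ : Ctx → Term → Term → Set where
    axiom : ∀ {c s} → Ax c s → [] ⊢ const c ∶ const s
    start : ∀ {Γ A s} → Sort s → Γ ⊢ A ∶ const s → (A ∷ Γ) ⊢ var zero ∶ shift A
    weak  : ∀ {Γ M B A s} → Sort s → Γ ⊢ M ∶ B → Γ ⊢ A ∶ const s →
            (A ∷ Γ) ⊢ shift M ∶ shift B
    appl  : ∀ {Γ M N A B} → Γ ⊢ M ∶ Pi A B → Γ ⊢ N ∶ A → Γ ⊢ app M N ∶ (B [ N ])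
    abst  : ∀ {Γ A M B s} → Sort s → (A ∷ Γ) ⊢ M ∶ B → Γ ⊢ Pi A B ∶ const s →
            Γ ⊢ lam A M ∶ Pi A B
    prod  : ∀ {Γ A B s₁ s₂ s₃} → (A ∷ Γ) ⊢ B ∶ const s₂ → Γ ⊢ A ∶ const s₁ →
            Rule s₁ s₂ s₃ → Γ ⊢ Pi A B ∶ const s₃
    conv  : ∀ {Γ M A B s} → Sort s → Γ ⊢ M ∶ A → Γ ⊢ B ∶ const s → A =β B →
            Γ ⊢ M ∶ B

  Inhabited : Const → Set
  Inhabited s = Sort s × ∃ λ A → [] ⊢ A ∶ const s

  NFInhabited : Const → Set
  NFInhabited s = Sort s × ∃ λ A → NormalForm A × ([] ⊢ A ∶ const s)

  -- Hilbert-style PTS with specification (S, A, B).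
  -- An axiom scheme has k sort variables; it is a judgement ⊢ M : A
  -- whose terms may mention the sort variables (constants in Fin k).

  record Scheme : Set where
    constructor scheme
    field
      k    : ℕ
      subj : Tm (Const ⊎ Fin k)
      typ  : Tm (Const ⊎ Fin k)

  inst : {k : ℕ} → (Fin k → Const) → Tm (Const ⊎ Fin k) → Term
  inst σ = mapC [ id , σ ]

  module HPTS (B : List Scheme) where
    infix 3 ⊢H_∶_
    data ⊢H_∶_ : Term → Term → Set where
      axiom  : ∀ {c s} → Ax c s → ⊢H const c ∶ const s
      scheme : ∀ {b} → b ∈ B → (σ : Fin (Scheme.k b) → Const) → (∀ i → Sort (σ i)) →
               ⊢H inst σ (Scheme.subj b) ∶ inst σ (Scheme.typ b)
      appl   : ∀ {M N A C} → ⊢H M ∶ Pi A C → ⊢H N ∶ A → ⊢H app M N ∶ (C [ N ])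
      conv   : ∀ {M A C s} → Sort s → ⊢H M ∶ A → ⊢H C ∶ const s → A =β C → ⊢H M ∶ C
      tyred  : ∀ {M A C} → ⊢H M ∶ A → A ⟶β C → ⊢H M ∶ C
      subred : ∀ {M N A} → ⊢H M ∶ A → M ⟶β N → ⊢H N ∶ A

  Equivalent : List Scheme → Set
  Equivalent B = ∀ M A → ([] ⊢ M ∶ A → HPTS.⊢H_∶_ B M A) × (HPTS.⊢H_∶_ B M A → [] ⊢ M ∶ A)

-- Suppose the HPTS with schemes B were equivalent to λX, and let u = s₁.
-- An HPTS derivation of ⊢ T : u cannot end in an application F N : C[N]: in λX,
-- x:A ⊢ C : s₂ for a rule (s₁', s₂, s₃), so subject reduction along C[N] ↠ u would
-- give an axiom u : s₂. Hence every inhabitant of u that is not a constant is an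
-- instance of a reduct of the subject of some scheme. Going once around the cycle
-- s₁, …, sₙ = s₁ with non-dependent products, a normal inhabitant of u yields
-- inhabitants Π x₁:C₁ … Π xₖ:Cₖ. A₀ of u for infinitely many k. Such a k is invariant
-- under reduction, so by confluence two instances of reducts of one scheme subject
-- have the same k; by pigeonhole, |B| + 1 of these inhabitants cannot all come
-- from different schemes.
module Submission where

open import Defs
open import Data.Nat using (ℕ; zero; suc; _+_; _*_; _<_; _≤_; s≤s; z≤n)
open import Data.Nat.Properties using (+-assoc; <⇒≤; ≤-refl; n<1+n; <⇒≢; +-monoˡ-<; *-monoˡ-<)
open import Data.Fin using (Fin; toℕ)
open import Data.Fin.Properties using (pigeonhole)
open import Data.Product using (Σ; ∃; ∃₂; _×_; _,_; proj₁; proj₂)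
open import Data.Sum using (_⊎_; inj₁; inj₂; [_,_])
open import Data.Unit using (⊤; tt)
open import Data.Empty using (⊥-elim)
open import Data.List using (List; []; _∷_; length; lookup)
open import Data.List.Relation.Unary.Any using (index)
open import Data.List.Relation.Unary.Any.Properties using (lookup-index)
open import Function using (_∘_; id)
open import Relation.Nullary using (¬_)
open import Relation.Binary.PropositionalEquality
  using (_≡_; _≗_; refl; sym; trans; cong; cong₂; subst₂; module ≡-Reasoning)
  renaming (subst to transport)
open import Relation.Binary.Construct.Closure.ReflexiveTransitive
  using (Star; ε; _◅_; _◅◅_; gmap; concat) renaming (map to Star-map)
open import Relation.Binary.Construct.Closure.Symmetric using (fwd; bwd)
import Relation.Binary.Construct.Closure.Equivalence as EqClosure

-- Renaming and substitution

module _ {X : Set} where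

  extR-cong : ∀ {ρ ρ'} → ρ ≗ ρ' → extR {X} ρ ≗ extR {X} ρ'
  extR-cong h zero    = refl
  extR-cong h (suc i) = cong suc (h i)

  rename-cong : ∀ {ρ ρ'} → ρ ≗ ρ' → rename {X} ρ ≗ rename ρ'
  rename-cong h (var i)   = cong var (h i)
  rename-cong h (const c) = refl
  rename-cong h (Pi A B)  = cong₂ Pi (rename-cong h A) (rename-cong (extR-cong h) B)
  rename-cong h (lam A M) = cong₂ lam (rename-cong h A) (rename-cong (extR-cong h) M)
  rename-cong h (app M N) = cong₂ app (rename-cong h M) (rename-cong h N)

  extS-cong : ∀ {σ τ : ℕ → Tm X} → σ ≗ τ → extS σ ≗ extS τ
  extS-cong h zero    = refl
  extS-cong h (suc i) = cong shift (h i)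

  subst-cong : ∀ {σ τ : ℕ → Tm X} → σ ≗ τ → subst σ ≗ subst τ
  subst-cong h (var i)   = h i
  subst-cong h (const c) = refl
  subst-cong h (Pi A B)  = cong₂ Pi (subst-cong h A) (subst-cong (extS-cong h) B)
  subst-cong h (lam A M) = cong₂ lam (subst-cong h A) (subst-cong (extS-cong h) M)
  subst-cong h (app M N) = cong₂ app (subst-cong h M) (subst-cong h N)

  extR-∘ : ∀ ρ ρ' → extR {X} ρ ∘ extR {X} ρ' ≗ extR {X} (ρ ∘ ρ')
  extR-∘ ρ ρ' zero    = refl
  extR-∘ ρ ρ' (suc i) = refl

  rename-∘ : ∀ ρ ρ' (M : Tm X) → rename ρ (rename ρ' M) ≡ rename (ρ ∘ ρ') M
  rename-∘ ρ ρ' (var i)   = refl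
  rename-∘ ρ ρ' (const c) = refl
  rename-∘ ρ ρ' (Pi A B)  = cong₂ Pi (rename-∘ ρ ρ' A)
    (trans (rename-∘ (extR {X} ρ) (extR {X} ρ') B) (rename-cong (extR-∘ ρ ρ') B))
  rename-∘ ρ ρ' (lam A M) = cong₂ lam (rename-∘ ρ ρ' A)
    (trans (rename-∘ (extR {X} ρ) (extR {X} ρ') M) (rename-cong (extR-∘ ρ ρ') M))
  rename-∘ ρ ρ' (app M N) = cong₂ app (rename-∘ ρ ρ' M) (rename-∘ ρ ρ' N)

  extS-extR : ∀ (σ : ℕ → Tm X) ρ → extS σ ∘ extR {X} ρ ≗ extS (σ ∘ ρ)
  extS-extR σ ρ zero    = refl
  extS-extR σ ρ (suc i) = refl

  subst-rename : ∀ (σ : ℕ → Tm X) ρ M → subst σ (rename ρ M) ≡ subst (σ ∘ ρ) M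
  subst-rename σ ρ (var i)   = refl
  subst-rename σ ρ (const c) = refl
  subst-rename σ ρ (Pi A B)  = cong₂ Pi (subst-rename σ ρ A)
    (trans (subst-rename (extS σ) (extR {X} ρ) B) (subst-cong (extS-extR σ ρ) B))
  subst-rename σ ρ (lam A M) = cong₂ lam (subst-rename σ ρ A)
    (trans (subst-rename (extS σ) (extR {X} ρ) M) (subst-cong (extS-extR σ ρ) M))
  subst-rename σ ρ (app M N) = cong₂ app (subst-rename σ ρ M) (subst-rename σ ρ N)

  extR-extS : ∀ ρ (σ : ℕ → Tm X) → rename (extR {X} ρ) ∘ extS σ ≗ extS (rename ρ ∘ σ)
  extR-extS ρ σ zero    = refl
  extR-extS ρ σ (suc i) = trans (rename-∘ (extR {X} ρ) suc (σ i)) (sym (rename-∘ suc ρ (σ i)))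

  rename-subst : ∀ ρ (σ : ℕ → Tm X) M → rename ρ (subst σ M) ≡ subst (rename ρ ∘ σ) M
  rename-subst ρ σ (var i)   = refl
  rename-subst ρ σ (const c) = refl
  rename-subst ρ σ (Pi A B)  = cong₂ Pi (rename-subst ρ σ A)
    (trans (rename-subst (extR {X} ρ) (extS σ) B) (subst-cong (extR-extS ρ σ) B))
  rename-subst ρ σ (lam A M) = cong₂ lam (rename-subst ρ σ A)
    (trans (rename-subst (extR {X} ρ) (extS σ) M) (subst-cong (extR-extS ρ σ) M))
  rename-subst ρ σ (app M N) = cong₂ app (rename-subst ρ σ M) (rename-subst ρ σ N)

  extS-∘ : ∀ (σ τ : ℕ → Tm X) → subst (extS σ) ∘ extS τ ≗ extS (subst σ ∘ τ)
  extS-∘ σ τ zero    = refl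
  extS-∘ σ τ (suc i) = trans (subst-rename (extS σ) suc (τ i)) (sym (rename-subst suc σ (τ i)))

  subst-∘ : ∀ (σ τ : ℕ → Tm X) M → subst σ (subst τ M) ≡ subst (subst σ ∘ τ) M
  subst-∘ σ τ (var i)   = refl
  subst-∘ σ τ (const c) = refl
  subst-∘ σ τ (Pi A B)  = cong₂ Pi (subst-∘ σ τ A)
    (trans (subst-∘ (extS σ) (extS τ) B) (subst-cong (extS-∘ σ τ) B))
  subst-∘ σ τ (lam A M) = cong₂ lam (subst-∘ σ τ A)
    (trans (subst-∘ (extS σ) (extS τ) M) (subst-cong (extS-∘ σ τ) M))
  subst-∘ σ τ (app M N) = cong₂ app (subst-∘ σ τ M) (subst-∘ σ τ N)

  extS-var : extS {X} var ≗ var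
  extS-var zero    = refl
  extS-var (suc i) = refl

  subst-var : (M : Tm X) → subst var M ≡ M
  subst-var (var i)   = refl
  subst-var (const c) = refl
  subst-var (Pi A B)  = cong₂ Pi (subst-var A) (trans (subst-cong extS-var B) (subst-var B))
  subst-var (lam A M) = cong₂ lam (subst-var A) (trans (subst-cong extS-var M) (subst-var M))
  subst-var (app M N) = cong₂ app (subst-var M) (subst-var N)

  rename-as-subst : ∀ ρ (M : Tm X) → rename ρ M ≡ subst (var ∘ ρ) M
  rename-as-subst ρ M = trans (sym (subst-var (rename ρ M))) (subst-rename var ρ M)

  subst-[] : ∀ (σ : ℕ → Tm X) M N → subst σ (M [ N ]) ≡ subst (extS σ) M [ subst σ N ]
  subst-[] σ M N = begin
    subst σ (M [ N ])                              ≡⟨ subst-∘ σ (single N) M ⟩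
    subst (subst σ ∘ single N) M                   ≡⟨ subst-cong commute M ⟩
    subst (subst (single (subst σ N)) ∘ extS σ) M  ≡⟨ subst-∘ (single (subst σ N)) (extS σ) M ⟨
    subst (extS σ) M [ subst σ N ]                 ∎
    where
    open ≡-Reasoning
    commute : subst σ ∘ single N ≗ subst (single (subst σ N)) ∘ extS σ
    commute zero    = refl
    commute (suc i) = sym (trans (subst-rename (single (subst σ N)) suc (σ i)) (subst-var (σ i)))

  extS-var∘ : ∀ ρ → extS {X} (var ∘ ρ) ≗ var ∘ extR {X} ρ
  extS-var∘ ρ zero    = refl
  extS-var∘ ρ (suc i) = refl

  rename-extR-as-subst : ∀ ρ (M : Tm X) → rename (extR {X} ρ) M ≡ subst (extS (var ∘ ρ)) M
  rename-extR-as-subst ρ M = trans (rename-as-subst (extR {X} ρ) M) (sym (subst-cong (extS-var∘ ρ) M))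

  rename-[] : ∀ ρ (M N : Tm X) → rename ρ (M [ N ]) ≡ rename (extR {X} ρ) M [ rename ρ N ]
  rename-[] ρ M N = begin
    rename ρ (M [ N ])                                  ≡⟨ rename-as-subst ρ (M [ N ]) ⟩
    subst (var ∘ ρ) (M [ N ])                           ≡⟨ subst-[] (var ∘ ρ) M N ⟩
    subst (extS (var ∘ ρ)) M [ subst (var ∘ ρ) N ]      ≡⟨ cong₂ _[_] (rename-extR-as-subst ρ M) (rename-as-subst ρ N) ⟨
    rename (extR {X} ρ) M [ rename ρ N ]                    ∎
    where open ≡-Reasoning

  rename-Pi-inv : ∀ ρ (M : Tm X) {A B} → rename ρ M ≡ Pi A B →
                  ∃₂ λ A₀ B₀ → M ≡ Pi A₀ B₀ × A ≡ rename ρ A₀ × B ≡ rename (extR {X} ρ) B₀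
  rename-Pi-inv ρ (var i)    ()
  rename-Pi-inv ρ (const c)  ()
  rename-Pi-inv ρ (Pi A₀ B₀) refl = A₀ , B₀ , refl , refl , refl
  rename-Pi-inv ρ (lam A M)  ()
  rename-Pi-inv ρ (app M N)  ()

module _ {X Y : Set} (f : X → Y) where

  -- extR carries an unused implicit argument, so extR {X} ρ and extR {Y} ρ
  -- are only pointwise equal for a variable ρ.
  extR-irrelevant : ∀ ρ → extR {X} ρ ≗ extR {Y} ρ
  extR-irrelevant ρ zero    = refl
  extR-irrelevant ρ (suc i) = refl

  mapC-rename : ∀ ρ (M : Tm X) → mapC f (rename ρ M) ≡ rename ρ (mapC f M)
  mapC-rename ρ (var i)   = refl
  mapC-rename ρ (const c) = refl
  mapC-rename ρ (Pi A B)  = cong₂ Pi (mapC-rename ρ A)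
    (trans (mapC-rename (extR {X} ρ) B) (rename-cong (extR-irrelevant ρ) (mapC f B)))
  mapC-rename ρ (lam A M) = cong₂ lam (mapC-rename ρ A)
    (trans (mapC-rename (extR {X} ρ) M) (rename-cong (extR-irrelevant ρ) (mapC f M)))
  mapC-rename ρ (app M N) = cong₂ app (mapC-rename ρ M) (mapC-rename ρ N)

  mapC-extS : ∀ (σ : ℕ → Tm X) → mapC f ∘ extS σ ≗ extS (mapC f ∘ σ)
  mapC-extS σ zero    = refl
  mapC-extS σ (suc i) = mapC-rename suc (σ i)

  mapC-subst : ∀ (σ : ℕ → Tm X) M → mapC f (subst σ M) ≡ subst (mapC f ∘ σ) (mapC f M)
  mapC-subst σ (var i)   = refl
  mapC-subst σ (const c) = refl
  mapC-subst σ (Pi A B)  = cong₂ Pi (mapC-subst σ A)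
    (trans (mapC-subst (extS σ) B) (subst-cong (mapC-extS σ) (mapC f B)))
  mapC-subst σ (lam A M) = cong₂ lam (mapC-subst σ A)
    (trans (mapC-subst (extS σ) M) (subst-cong (mapC-extS σ) (mapC f M)))
  mapC-subst σ (app M N) = cong₂ app (mapC-subst σ M) (mapC-subst σ N)

  mapC-single : ∀ N → mapC f ∘ single N ≗ single (mapC f N)
  mapC-single N zero    = refl
  mapC-single N (suc i) = refl

  mapC-[] : ∀ (M N : Tm X) → mapC f (M [ N ]) ≡ mapC f M [ mapC f N ]
  mapC-[] M N = trans (mapC-subst (single N) M) (subst-cong (mapC-single N) (mapC f M))

-- Confluence of β-reduction

module _ {X : Set} where

  infix 4 _↠_
  _↠_ : Tm X → Tm X → Set
  _↠_ = Star _⟶β_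

  Pi-↠ : ∀ {A A' B B'} → A ↠ A' → B ↠ B' → Pi A B ↠ Pi A' B'
  Pi-↠ {A' = A'} {B = B} p q = gmap (λ A → Pi A B) piL p ◅◅ gmap (Pi A') piR q

  lam-↠ : ∀ {A A' M M'} → A ↠ A' → M ↠ M' → lam A M ↠ lam A' M'
  lam-↠ {A' = A'} {M = M} p q = gmap (λ A → lam A M) lamL p ◅◅ gmap (lam A') lamR q

  app-↠ : ∀ {M M' N N'} → M ↠ M' → N ↠ N' → app M N ↠ app M' N'
  app-↠ {M' = M'} {N = N} p q = gmap (λ M → app M N) appL p ◅◅ gmap (app M') appR q

  subst-⟶β : ∀ (σ : ℕ → Tm X) {M N} → M ⟶β N → subst σ M ⟶β subst σ N
  subst-⟶β σ (beta {A} {M} {N}) =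
    transport (app (lam (subst σ A) (subst (extS σ) M)) (subst σ N) ⟶β_) (sym (subst-[] σ M N)) beta
  subst-⟶β σ (piL r)  = piL (subst-⟶β σ r)
  subst-⟶β σ (piR r)  = piR (subst-⟶β (extS σ) r)
  subst-⟶β σ (lamL r) = lamL (subst-⟶β σ r)
  subst-⟶β σ (lamR r) = lamR (subst-⟶β (extS σ) r)
  subst-⟶β σ (appL r) = appL (subst-⟶β σ r)
  subst-⟶β σ (appR r) = appR (subst-⟶β σ r)

  subst-=β : ∀ (σ : ℕ → Tm X) {M N} → M =β N → subst σ M =β subst σ N
  subst-=β σ = EqClosure.gmap (subst σ) (subst-⟶β σ)

  rename-=β : ∀ ρ {M N : Tm X} → M =β N → rename ρ M =β rename ρ N
  rename-=β ρ {M} {N} e = subst₂ _=β_ (sym (rename-as-subst ρ M)) (sym (rename-as-subst ρ N))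
    (subst-=β (var ∘ ρ) e)

  rename-reflects-⟶β : ∀ ρ (M : Tm X) {N} → rename ρ M ⟶β N → ∃ λ M' → M ⟶β M'
  rename-reflects-⟶β ρ (Pi A B) (piL r)  = let A' , r' = rename-reflects-⟶β ρ A r in Pi A' B , piL r'
  rename-reflects-⟶β ρ (Pi A B) (piR r)  = let B' , r' = rename-reflects-⟶β _ B r in Pi A B' , piR r'
  rename-reflects-⟶β ρ (lam A M) (lamL r) = let A' , r' = rename-reflects-⟶β ρ A r in lam A' M , lamL r'
  rename-reflects-⟶β ρ (lam A M) (lamR r) = let M' , r' = rename-reflects-⟶β _ M r in lam A M' , lamR r'
  rename-reflects-⟶β ρ (app (lam A M) N) beta = _ , beta
  rename-reflects-⟶β ρ (app M N) (appL r) = let M' , r' = rename-reflects-⟶β ρ M r in app M' N , appL r'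
  rename-reflects-⟶β ρ (app M N) (appR r) = let N' , r' = rename-reflects-⟶β ρ N r in app M N' , appR r'

  rename-NormalForm : ∀ ρ {M : Tm X} → NormalForm M → NormalForm (rename ρ M)
  rename-NormalForm ρ {M} nf _ r = let M' , r' = rename-reflects-⟶β ρ M r in nf M' r'

  const-↠ : ∀ {c : X} {N} → const c ↠ N → N ≡ const c
  const-↠ ε       = refl
  const-↠ (() ◅ _)

  infix 4 _⇛_
  data _⇛_ : Tm X → Tm X → Set where
    var   : ∀ {i} → var i ⇛ var i
    const : ∀ {c} → const c ⇛ const c
    Pi    : ∀ {A A' B B'} → A ⇛ A' → B ⇛ B' → Pi A B ⇛ Pi A' B'
    lam   : ∀ {A A' M M'} → A ⇛ A' → M ⇛ M' → lam A M ⇛ lam A' M'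
    app   : ∀ {M M' N N'} → M ⇛ M' → N ⇛ N' → app M N ⇛ app M' N'
    beta  : ∀ {A M M' N N'} → M ⇛ M' → N ⇛ N' → app (lam A M) N ⇛ M' [ N' ]

  ⇛-refl : ∀ (M : Tm X) → M ⇛ M
  ⇛-refl (var i)   = var
  ⇛-refl (const c) = const
  ⇛-refl (Pi A B)  = Pi (⇛-refl A) (⇛-refl B)
  ⇛-refl (lam A M) = lam (⇛-refl A) (⇛-refl M)
  ⇛-refl (app M N) = app (⇛-refl M) (⇛-refl N)

  ⟶β⇒⇛ : ∀ {M N : Tm X} → M ⟶β N → M ⇛ N
  ⟶β⇒⇛ (beta {M = M} {N}) = beta (⇛-refl M) (⇛-refl N)
  ⟶β⇒⇛ (piL r)  = Pi (⟶β⇒⇛ r) (⇛-refl _)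
  ⟶β⇒⇛ (piR r)  = Pi (⇛-refl _) (⟶β⇒⇛ r)
  ⟶β⇒⇛ (lamL r) = lam (⟶β⇒⇛ r) (⇛-refl _)
  ⟶β⇒⇛ (lamR r) = lam (⇛-refl _) (⟶β⇒⇛ r)
  ⟶β⇒⇛ (appL r) = app (⟶β⇒⇛ r) (⇛-refl _)
  ⟶β⇒⇛ (appR r) = app (⇛-refl _) (⟶β⇒⇛ r)

  ⇛⇒↠ : ∀ {M N : Tm X} → M ⇛ N → M ↠ N
  ⇛⇒↠ var         = ε
  ⇛⇒↠ const       = ε
  ⇛⇒↠ (Pi p q)    = Pi-↠ (⇛⇒↠ p) (⇛⇒↠ q)
  ⇛⇒↠ (lam p q)   = lam-↠ (⇛⇒↠ p) (⇛⇒↠ q)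
  ⇛⇒↠ (app p q)   = app-↠ (⇛⇒↠ p) (⇛⇒↠ q)
  ⇛⇒↠ (beta p q)  = app-↠ (lam-↠ ε (⇛⇒↠ p)) (⇛⇒↠ q) ◅◅ (beta ◅ ε)

  ⇛-rename : ∀ ρ {M N : Tm X} → M ⇛ N → rename ρ M ⇛ rename ρ N
  ⇛-rename ρ var        = var
  ⇛-rename ρ const      = const
  ⇛-rename ρ (Pi p q)   = Pi (⇛-rename ρ p) (⇛-rename _ q)
  ⇛-rename ρ (lam p q)  = lam (⇛-rename ρ p) (⇛-rename _ q)
  ⇛-rename ρ (app p q)  = app (⇛-rename ρ p) (⇛-rename ρ q)
  ⇛-rename ρ (beta {M' = M'} {N' = N'} p q) =
    transport (_ ⇛_) (sym (rename-[] ρ M' N')) (beta (⇛-rename _ p) (⇛-rename ρ q))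

  ⇛-extS : ∀ {σ τ : ℕ → Tm X} → (∀ i → σ i ⇛ τ i) → ∀ i → extS σ i ⇛ extS τ i
  ⇛-extS h zero    = var
  ⇛-extS h (suc i) = ⇛-rename suc (h i)

  ⇛-subst : ∀ {σ τ : ℕ → Tm X} → (∀ i → σ i ⇛ τ i) → ∀ {M N} → M ⇛ N → subst σ M ⇛ subst τ N
  ⇛-subst h var       = h _
  ⇛-subst h const     = const
  ⇛-subst h (Pi p q)  = Pi (⇛-subst h p) (⇛-subst (⇛-extS h) q)
  ⇛-subst h (lam p q) = lam (⇛-subst h p) (⇛-subst (⇛-extS h) q)
  ⇛-subst h (app p q) = app (⇛-subst h p) (⇛-subst h q)
  ⇛-subst {τ = τ} h (beta {M' = M'} {N' = N'} p q) =
    transport (_ ⇛_) (sym (subst-[] τ M' N')) (beta (⇛-subst (⇛-extS h) p) (⇛-subst h q))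

  ⇛-[] : ∀ {M M' N N' : Tm X} → M ⇛ M' → N ⇛ N' → M [ N ] ⇛ M' [ N' ]
  ⇛-[] p q = ⇛-subst (λ { zero → q ; (suc i) → var }) p

  -- Takahashi's complete development; ⇛-development is its triangle property.
  development : Tm X → Tm X
  development (var i)           = var i
  development (const c)         = const c
  development (Pi A B)          = Pi (development A) (development B)
  development (lam A M)         = lam (development A) (development M)
  development (app (lam A M) N) = development M [ development N ]
  development (app M N)         = app (development M) (development N)

  ⇛-development : ∀ {M N : Tm X} → M ⇛ N → N ⇛ development M
  ⇛-development var        = var
  ⇛-development const      = const
  ⇛-development (Pi p q)   = Pi (⇛-development p) (⇛-development q)
  ⇛-development (lam p q)  = lam (⇛-development p) (⇛-development q)
  ⇛-development (app var q)          = app var (⇛-development q)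
  ⇛-development (app const q)        = app const (⇛-development q)
  ⇛-development (app p@(Pi _ _) q)   = app (⇛-development p) (⇛-development q)
  ⇛-development (app (lam _ p) q)    = beta (⇛-development p) (⇛-development q)
  ⇛-development (app p@(app _ _) q)  = app (⇛-development p) (⇛-development q)
  ⇛-development (app p@(beta _ _) q) = app (⇛-development p) (⇛-development q)
  ⇛-development (beta p q) = ⇛-[] (⇛-development p) (⇛-development q)

  ⇛*-strip : ∀ {M N P : Tm X} → M ⇛ N → Star _⇛_ M P → ∃ λ W → Star _⇛_ N W × P ⇛ W
  ⇛*-strip {N = N} p ε = N , ε , p
  ⇛*-strip p (q ◅ qs) =
    let W , r , w = ⇛*-strip (⇛-development q) qs in W , ⇛-development p ◅ r , w

  ⇛*-confluent : ∀ {M N P : Tm X} → Star _⇛_ M N → Star _⇛_ M P →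
                 ∃ λ W → Star _⇛_ N W × Star _⇛_ P W
  ⇛*-confluent {P = P} ε qs = P , qs , ε
  ⇛*-confluent (p ◅ ps) qs =
    let W₁ , qs₁ , p₁ = ⇛*-strip p qs
        W₂ , ps₂ , qs₂ = ⇛*-confluent ps qs₁
    in W₂ , ps₂ , p₁ ◅ qs₂

  ↠-confluent : ∀ {M N P : Tm X} → M ↠ N → M ↠ P → ∃ λ W → N ↠ W × P ↠ W
  ↠-confluent r₁ r₂ =
    let W , p₁ , p₂ = ⇛*-confluent (Star-map ⟶β⇒⇛ r₁) (Star-map ⟶β⇒⇛ r₂)
    in W , concat (Star-map ⇛⇒↠ p₁) , concat (Star-map ⇛⇒↠ p₂)

  church-rosser : ∀ {M N : Tm X} → M =β N → ∃ λ W → M ↠ W × N ↠ W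
  church-rosser {M} ε = M , ε , ε
  church-rosser (fwd r ◅ e) = let W , p , q = church-rosser e in W , r ◅ p , q
  church-rosser (bwd r ◅ e) =
    let W , p , q = church-rosser e
        W' , p' , q' = ↠-confluent (r ◅ ε) p
    in W' , p' , q ◅◅ q'

  =β-const⇒↠ : ∀ {M : Tm X} {c} → M =β const c → M ↠ const c
  =β-const⇒↠ e = let _ , p , q = church-rosser e in transport (_ ↠_) (const-↠ q) p

  const-injective-=β : ∀ {c d : X} → const c =β const d → c ≡ d
  const-injective-=β e with _ , p , q ← church-rosser e with refl ← trans (sym (const-↠ p)) (const-↠ q) = refl

module _ {X Y : Set} (f : X → Y) where

  mapC-⟶β : ∀ {M N : Tm X} → M ⟶β N → mapC f M ⟶β mapC f N
  mapC-⟶β (beta {A} {M} {N}) =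
    transport (app (lam (mapC f A) (mapC f M)) (mapC f N) ⟶β_) (sym (mapC-[] f M N)) beta
  mapC-⟶β (piL r)  = piL (mapC-⟶β r)
  mapC-⟶β (piR r)  = piR (mapC-⟶β r)
  mapC-⟶β (lamL r) = lamL (mapC-⟶β r)
  mapC-⟶β (lamR r) = lamR (mapC-⟶β r)
  mapC-⟶β (appL r) = appL (mapC-⟶β r)
  mapC-⟶β (appR r) = appR (mapC-⟶β r)

  mapC-↠ : ∀ {M N : Tm X} → M ↠ N → mapC f M ↠ mapC f N
  mapC-↠ = gmap (mapC f) mapC-⟶β

  mapC-reflects-⟶β : ∀ (M : Tm X) {N} → mapC f M ⟶β N → ∃ λ M' → M ⟶β M' × N ≡ mapC f M'
  mapC-reflects-⟶β (Pi A B) (piL r) =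
    let A' , r' , e = mapC-reflects-⟶β A r in Pi A' B , piL r' , cong (λ A → Pi A (mapC f B)) e
  mapC-reflects-⟶β (Pi A B) (piR r) =
    let B' , r' , e = mapC-reflects-⟶β B r in Pi A B' , piR r' , cong (Pi (mapC f A)) e
  mapC-reflects-⟶β (lam A M) (lamL r) =
    let A' , r' , e = mapC-reflects-⟶β A r in lam A' M , lamL r' , cong (λ A → lam A (mapC f M)) e
  mapC-reflects-⟶β (lam A M) (lamR r) =
    let M' , r' , e = mapC-reflects-⟶β M r in lam A M' , lamR r' , cong (lam (mapC f A)) e
  mapC-reflects-⟶β (app (lam A M) N) beta = M [ N ] , beta , sym (mapC-[] f M N)
  mapC-reflects-⟶β (app M N) (appL r) =
    let M' , r' , e = mapC-reflects-⟶β M r in app M' N , appL r' , cong (λ M → app M (mapC f N)) e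
  mapC-reflects-⟶β (app M N) (appR r) =
    let N' , r' , e = mapC-reflects-⟶β N r in app M N' , appR r' , cong (app (mapC f M)) e

  mapC-reflects-↠ : ∀ (M : Tm X) {N} → mapC f M ↠ N → ∃ λ M' → M ↠ M' × N ≡ mapC f M'
  mapC-reflects-↠ M ε = M , ε , refl
  mapC-reflects-↠ M (r ◅ rs) with M₁ , r₁ , refl ← mapC-reflects-⟶β M r =
    let M₂ , r₂ , e = mapC-reflects-↠ M₁ rs in M₂ , r₁ ◅ r₂ , e

-- Metatheory of pure type systems

module Metatheory (P : Spec) where
  open Spec P
  open PTS P

  WfCtx : Ctx → Set
  WfCtx []      = ⊤
  WfCtx (A ∷ Γ) = WfCtx Γ × ∃ λ s → Sort s × Γ ⊢ A ∶ const s

  ⊢⇒WfCtx : ∀ {Γ M T} → Γ ⊢ M ∶ T → WfCtx Γ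
  ⊢⇒WfCtx (axiom _)        = tt
  ⊢⇒WfCtx (start s ⊢A)     = ⊢⇒WfCtx ⊢A , _ , s , ⊢A
  ⊢⇒WfCtx (weak s _ ⊢A)    = ⊢⇒WfCtx ⊢A , _ , s , ⊢A
  ⊢⇒WfCtx (appl ⊢M _)      = ⊢⇒WfCtx ⊢M
  ⊢⇒WfCtx (abst _ _ ⊢Pi)   = ⊢⇒WfCtx ⊢Pi
  ⊢⇒WfCtx (prod _ ⊢A _)    = ⊢⇒WfCtx ⊢A
  ⊢⇒WfCtx (conv _ ⊢M _ _)  = ⊢⇒WfCtx ⊢M

  infix 3 _⊢ˢ_∶_
  _⊢ˢ_∶_ : Ctx → (ℕ → Term) → Ctx → Set
  Δ ⊢ˢ σ ∶ []      = WfCtx Δ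
  Δ ⊢ˢ σ ∶ (A ∷ Γ) = Δ ⊢ σ 0 ∶ subst (σ ∘ suc) A × Δ ⊢ˢ σ ∘ suc ∶ Γ

  ⊢-axiom : ∀ {Δ c s} → WfCtx Δ → Ax c s → Δ ⊢ const c ∶ const s
  ⊢-axiom {[]}    _                   ax = axiom ax
  ⊢-axiom {_ ∷ Δ} (wf , _ , s , ⊢A) ax = weak s (⊢-axiom wf ax) ⊢A

  ⊢ˢ-weaken : ∀ {Δ} Γ {σ B s} → Δ ⊢ˢ σ ∶ Γ → Sort s → Δ ⊢ B ∶ const s → (B ∷ Δ) ⊢ˢ shift ∘ σ ∶ Γ
  ⊢ˢ-weaken []      wf          s ⊢B = wf , _ , s , ⊢B
  ⊢ˢ-weaken {Δ} (A ∷ Γ) {σ} {B} (⊢σ₀ , ⊢σ) s ⊢B =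
    transport (B ∷ Δ ⊢ shift (σ 0) ∶_) (rename-subst suc _ A) (weak s ⊢σ₀ ⊢B) , ⊢ˢ-weaken Γ ⊢σ s ⊢B

  ⊢ˢ-lift : ∀ {Δ} Γ {σ A s} → Δ ⊢ˢ σ ∶ Γ → Sort s → Δ ⊢ subst σ A ∶ const s →
            (subst σ A ∷ Δ) ⊢ˢ extS σ ∶ (A ∷ Γ)
  ⊢ˢ-lift {Δ} Γ {σ} {A} ⊢σ s ⊢σA =
    transport (subst σ A ∷ Δ ⊢ var 0 ∶_) (rename-subst suc σ A) (start s ⊢σA) , ⊢ˢ-weaken Γ ⊢σ s ⊢σA

  ⊢ˢ-id : ∀ {Γ} → WfCtx Γ → Γ ⊢ˢ var ∶ Γ
  ⊢ˢ-id {[]}    _                    = tt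
  ⊢ˢ-id {A ∷ Γ} (wf , _ , s , ⊢A) =
    transport (A ∷ Γ ⊢ var 0 ∶_) (rename-as-subst suc A) (start s ⊢A) , ⊢ˢ-weaken Γ (⊢ˢ-id wf) s ⊢A

  ⊢ˢ-single : ∀ {Γ N A} → Γ ⊢ N ∶ A → Γ ⊢ˢ single N ∶ (A ∷ Γ)
  ⊢ˢ-single {Γ} {N} ⊢N = transport (Γ ⊢ N ∶_) (sym (subst-var _)) ⊢N , ⊢ˢ-id (⊢⇒WfCtx ⊢N)

  Pi-domain-typed : ∀ {Γ M T A B} → Γ ⊢ M ∶ T → M ≡ Pi A B → ∃ λ s → Sort s × Γ ⊢ A ∶ const s
  Pi-domain-typed (weak {M = M} s ⊢M ⊢A') eq with rename-Pi-inv suc M eq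
  ... | _ , _ , refl , refl , refl =
    let s' , s'-sort , ⊢A = Pi-domain-typed ⊢M refl in s' , s'-sort , weak s ⊢A ⊢A'
  Pi-domain-typed (prod _ ⊢A r) refl = _ , proj₁ (Rule-sort r) , ⊢A
  Pi-domain-typed (conv _ ⊢M _ _) eq = Pi-domain-typed ⊢M eq

  ⊢-subst : ∀ {Γ M T Δ} σ → Γ ⊢ M ∶ T → Δ ⊢ˢ σ ∶ Γ → Δ ⊢ subst σ M ∶ subst σ T
  ⊢-subst σ (axiom ax) wf = ⊢-axiom wf ax
  ⊢-subst {Δ = Δ} σ (start {A = A} _ _) (⊢σ₀ , _) =
    transport (Δ ⊢ σ 0 ∶_) (sym (subst-rename σ suc A)) ⊢σ₀
  ⊢-subst {Δ = Δ} σ (weak {M = M} {B = B} _ ⊢M _) (_ , ⊢σ) =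
    subst₂ (Δ ⊢_∶_) (sym (subst-rename σ suc M)) (sym (subst-rename σ suc B)) (⊢-subst (σ ∘ suc) ⊢M ⊢σ)
  ⊢-subst {Δ = Δ} σ (appl {M = M} {N} {B = B} ⊢M ⊢N) ⊢σ =
    transport (Δ ⊢ subst σ (app M N) ∶_) (sym (subst-[] σ B N)) (appl (⊢-subst σ ⊢M ⊢σ) (⊢-subst σ ⊢N ⊢σ))
  ⊢-subst σ (abst {Γ = Γ} {A} s ⊢M ⊢Pi) ⊢σ =
    let ⊢σPi = ⊢-subst σ ⊢Pi ⊢σ
        _ , s₁ , ⊢σA = Pi-domain-typed ⊢σPi refl
    in abst s (⊢-subst (extS σ) ⊢M (⊢ˢ-lift Γ {A = A} ⊢σ s₁ ⊢σA)) ⊢σPi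
  ⊢-subst σ (prod {Γ = Γ} {A} ⊢B ⊢A r) ⊢σ =
    let ⊢σA = ⊢-subst σ ⊢A ⊢σ
    in prod (⊢-subst (extS σ) ⊢B (⊢ˢ-lift Γ {A = A} ⊢σ (proj₁ (Rule-sort r)) ⊢σA)) ⊢σA r
  ⊢-subst σ (conv s ⊢M ⊢B e) ⊢σ = conv s (⊢-subst σ ⊢M ⊢σ) (⊢-subst σ ⊢B ⊢σ) (subst-=β σ e)

  ⊢-[] : ∀ {Γ A M T N} → (A ∷ Γ) ⊢ M ∶ T → Γ ⊢ N ∶ A → Γ ⊢ M [ N ] ∶ T [ N ]
  ⊢-[] ⊢M ⊢N = ⊢-subst _ ⊢M (⊢ˢ-single ⊢N)

  ⊢-weaken-under : ∀ {Γ A₀ A M s₀ s} → (A₀ ∷ Γ) ⊢ M ∶ const s₀ → Sort s → Γ ⊢ A ∶ const s →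
                   (shift A₀ ∷ A ∷ Γ) ⊢ rename (extR {Const} suc) M ∶ const s₀
  ⊢-weaken-under {Γ} {A₀} {A} {M} {s₀} ⊢M s ⊢A =
    let wk = ⊢ˢ-weaken Γ (⊢ˢ-id (⊢⇒WfCtx ⊢A)) s ⊢A
        _ , s₁ , ⊢A₀ = proj₂ (⊢⇒WfCtx ⊢M)
    in subst₂ (λ C M' → (C ∷ A ∷ Γ) ⊢ M' ∶ const s₀)
         (sym (rename-as-subst suc A₀)) (sym (rename-extR-as-subst suc M))
         (⊢-subst _ ⊢M (⊢ˢ-lift Γ {A = A₀} wk s₁ (⊢-subst _ ⊢A₀ wk)))

  Pi-generation : ∀ {Γ M T A B} → Γ ⊢ M ∶ T → M ≡ Pi A B →
    ∃ λ s₁ → ∃ λ s₂ → ∃ λ s₃ → Rule s₁ s₂ s₃ × (A ∷ Γ) ⊢ B ∶ const s₂ × T =β const s₃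
  Pi-generation (weak {M = M} s ⊢M ⊢A) eq with rename-Pi-inv suc M eq
  ... | _ , _ , refl , refl , refl =
    let s₁ , s₂ , s₃ , r , ⊢B , T=s₃ = Pi-generation ⊢M refl
    in s₁ , s₂ , s₃ , r , ⊢-weaken-under ⊢B s ⊢A , rename-=β suc T=s₃
  Pi-generation (prod ⊢B _ r) refl = _ , _ , _ , r , ⊢B , ε
  Pi-generation (conv _ ⊢M _ e) eq =
    let s₁ , s₂ , s₃ , r , ⊢B , T=s₃ = Pi-generation ⊢M eq
    in s₁ , s₂ , s₃ , r , ⊢B , EqClosure.symmetric _ e ◅◅ T=s₃

  Pi-codomain-[] : ∀ {Γ A C T N} → Γ ⊢ Pi A C ∶ T → Γ ⊢ N ∶ A →
    ∃ λ s₂ → (∃₂ λ s₁ s₃ → Rule s₁ s₂ s₃) × Γ ⊢ C [ N ] ∶ const s₂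
  Pi-codomain-[] ⊢Pi ⊢N =
    let s₁ , s₂ , s₃ , r , ⊢C , _ = Pi-generation ⊢Pi refl in s₂ , (s₁ , s₃ , r) , ⊢-[] ⊢C ⊢N

  correctness-of-types : ∀ {Γ M T} → Γ ⊢ M ∶ T →
    (∃ λ s → T ≡ const s) ⊎ (∃ λ s → Sort s × Γ ⊢ T ∶ const s)
  correctness-of-types (axiom _)     = inj₁ (_ , refl)
  correctness-of-types (start s ⊢A)  = inj₂ (_ , s , weak s ⊢A ⊢A)
  correctness-of-types (weak s ⊢M ⊢A) with correctness-of-types ⊢M
  ... | inj₁ (s' , refl)      = inj₁ (s' , refl)
  ... | inj₂ (s' , s'-sort , ⊢T) = inj₂ (s' , s'-sort , weak s ⊢T ⊢A)
  correctness-of-types (appl ⊢M ⊢N) with correctness-of-types ⊢M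
  ... | inj₂ (_ , _ , ⊢Pi) =
    let s₂ , (_ , _ , r) , ⊢C[N] = Pi-codomain-[] ⊢Pi ⊢N in inj₂ (s₂ , proj₁ (proj₂ (Rule-sort r)) , ⊢C[N])
  correctness-of-types (abst s _ ⊢Pi)  = inj₂ (_ , s , ⊢Pi)
  correctness-of-types (prod _ _ _)    = inj₁ (_ , refl)
  correctness-of-types (conv s _ ⊢B _) = inj₂ (_ , s , ⊢B)

  const-generation : ∀ {c T} → [] ⊢ const c ∶ T → ∃ λ t → Ax c t × T =β const t
  const-generation (axiom ax) = _ , ax , ε
  const-generation (conv _ ⊢c _ e) =
    let t , ax , T=t = const-generation ⊢c in t , ax , EqClosure.symmetric _ e ◅◅ T=t

-- Products over normal forms

module _ {X : Set} where

  piArity : Tm X → ℕ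
  piArity (Pi A B) = suc (piArity B)
  piArity _        = 0

  piArity-rename : ∀ ρ (M : Tm X) → piArity (rename ρ M) ≡ piArity M
  piArity-rename ρ (var i)   = refl
  piArity-rename ρ (const c) = refl
  piArity-rename ρ (Pi A B)  = cong suc (piArity-rename _ B)
  piArity-rename ρ (lam A M) = refl
  piArity-rename ρ (app M N) = refl

  -- Π x₁:C₁ … Π xⱼ:Cⱼ. N with N normal and k = j + piArity N: reductions only
  -- happen inside the Cᵢ, so k is the piArity of every reduct.
  data PiOverNF : ℕ → Tm X → Set where
    nf : ∀ {T} → NormalForm T → PiOverNF (piArity T) T
    pi : ∀ {k A B} → PiOverNF k B → PiOverNF (suc k) (Pi A B)

  PiOverNF⇒piArity : ∀ {k T} → PiOverNF k T → piArity T ≡ k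
  PiOverNF⇒piArity (nf _) = refl
  PiOverNF⇒piArity (pi p) = cong suc (PiOverNF⇒piArity p)

  PiOverNF-⟶β : ∀ {k T T'} → PiOverNF k T → T ⟶β T' → PiOverNF k T'
  PiOverNF-⟶β (nf T-nf) r       = ⊥-elim (T-nf _ r)
  PiOverNF-⟶β (pi p)    (piL r) = pi p
  PiOverNF-⟶β (pi p)    (piR r) = pi (PiOverNF-⟶β p r)

  PiOverNF-↠ : ∀ {k T T'} → PiOverNF k T → T ↠ T' → PiOverNF k T'
  PiOverNF-↠ p ε        = p
  PiOverNF-↠ p (r ◅ rs) = PiOverNF-↠ (PiOverNF-⟶β p r) rs

  PiOverNF-rename : ∀ ρ {k T} → PiOverNF k T → PiOverNF k (rename ρ T)
  PiOverNF-rename ρ {T = T} (nf T-nf) =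
    transport (λ k → PiOverNF k (rename ρ T)) (piArity-rename ρ T) (nf (rename-NormalForm ρ T-nf))
  PiOverNF-rename ρ (pi p) = pi (PiOverNF-rename _ p)

module _ {X Y : Set} where

  piArity-mapC : ∀ (f : X → Y) M → piArity (mapC f M) ≡ piArity M
  piArity-mapC f (var i)   = refl
  piArity-mapC f (const c) = refl
  piArity-mapC f (Pi A B)  = cong suc (piArity-mapC f B)
  piArity-mapC f (lam A M) = refl
  piArity-mapC f (app M N) = refl

  PiOverNF-arity-of-joinable-instances :
    ∀ (f g : X → Y) {u u₁ u₂ k₁ k₂} → u ↠ u₁ → u ↠ u₂ →
    PiOverNF k₁ (mapC f u₁) → PiOverNF k₂ (mapC g u₂) → k₁ ≡ k₂
  PiOverNF-arity-of-joinable-instances f g {k₁ = k₁} {k₂} r₁ r₂ p₁ p₂ =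
    let W , s₁ , s₂ = ↠-confluent r₁ r₂ in begin
      k₁                   ≡⟨ PiOverNF⇒piArity (PiOverNF-↠ p₁ (mapC-↠ f s₁)) ⟨
      piArity (mapC f W)   ≡⟨ piArity-mapC f W ⟩
      piArity W            ≡⟨ piArity-mapC g W ⟨
      piArity (mapC g W)   ≡⟨ PiOverNF⇒piArity (PiOverNF-↠ p₂ (mapC-↠ g s₂)) ⟩
      k₂                   ∎
    where open ≡-Reasoning

-- Inhabitants in a Hilbert-style system

module Hilbert (P : Spec) where
  open Spec P
  open PTS P
  open Metatheory P

  SubjectInstance : Scheme → Term → Set
  SubjectInstance b T =
    Σ (Fin (Scheme.k b) → Const) λ σ → ∃ λ u → Scheme.subj b ↠ u × T ≡ inst σ u

  module _ (B : List Scheme) (equivalent : Equivalent B) where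
    open HPTS B

    -- The HPTS has a rule (subject reduction), so the equivalence hands it to λX for free.
    subject-reduction : ∀ {M M' T} → [] ⊢ M ∶ T → M ↠ M' → [] ⊢ M' ∶ T
    subject-reduction {M} {M'} {T} ⊢M rs = proj₂ (equivalent M' T) (⊢H-↠ (proj₁ (equivalent M T) ⊢M) rs)
      where
      ⊢H-↠ : ∀ {M M'} → ⊢H M ∶ T → M ↠ M' → ⊢H M' ∶ T
      ⊢H-↠ ⊢M ε        = ⊢M
      ⊢H-↠ ⊢M (r ◅ rs) = ⊢H-↠ (subred ⊢M r) rs

    module _ {u} (u-not-axiom-in-rule : ∀ s₁ s₂ s₃ → Rule s₁ s₂ s₃ → ¬ Ax u s₂) where

      application-type-≠β : ∀ {F N A C} → [] ⊢ F ∶ Pi A C → [] ⊢ N ∶ A → ¬ (C [ N ] =β const u)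
      application-type-≠β ⊢F ⊢N C[N]=u with correctness-of-types ⊢F
      ... | inj₂ (_ , _ , ⊢Pi) =
        let s₂ , (s₁ , s₃ , r) , ⊢C[N] = Pi-codomain-[] ⊢Pi ⊢N
            t , ax , s₂=t = const-generation (subject-reduction ⊢C[N] (=β-const⇒↠ C[N]=u))
        in u-not-axiom-in-rule s₁ s₂ s₃ r (transport (Ax u) (sym (const-injective-=β s₂=t)) ax)

      -- The reduction M ↠ T absorbs the (subject reduction) steps of the derivation.
      inhabitant-shape : ∀ {M A T} → ⊢H M ∶ A → A =β const u → M ↠ T →
        (∃ λ c → T ≡ const c) ⊎ Σ (Fin (length B)) λ i → SubjectInstance (lookup B i) T
      inhabitant-shape (axiom _) _ r = inj₁ (_ , const-↠ r)
      inhabitant-shape {T = T} (scheme {b} b∈B σ _) _ r =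
        let v , rv , T≡σv = mapC-reflects-↠ [ id , σ ] (Scheme.subj b) r
        in inj₂ (index b∈B , transport (λ b → SubjectInstance b T) (lookup-index b∈B) (σ , v , rv , T≡σv))
      inhabitant-shape (appl ⊢F ⊢N) e _ =
        ⊥-elim (application-type-≠β (proj₂ (equivalent _ _) ⊢F) (proj₂ (equivalent _ _) ⊢N) e)
      inhabitant-shape (conv _ ⊢M _ e') e r = inhabitant-shape ⊢M (e' ◅◅ e) r
      inhabitant-shape (tyred ⊢M r') e r    = inhabitant-shape ⊢M (fwd r' ◅ e) r
      inhabitant-shape (subred ⊢M r') e r   = inhabitant-shape ⊢M e (r' ◅ r)

      scheme-of-product-type : ∀ {T k} → [] ⊢ T ∶ const u → PiOverNF (suc k) T →
        Σ (Fin (length B)) λ i → SubjectInstance (lookup B i) T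
      scheme-of-product-type {T} ⊢T p with inhabitant-shape (proj₁ (equivalent T (const u)) ⊢T) ε ε
      ... | inj₂ origin = origin
      ... | inj₁ (_ , refl) with () ← PiOverNF⇒piArity p

  same-scheme-same-arity : ∀ {b T T' k k'} → SubjectInstance b T → SubjectInstance b T' →
                           PiOverNF k T → PiOverNF k' T' → k ≡ k'
  same-scheme-same-arity (σ , _ , r , refl) (σ' , _ , r' , refl) =
    PiOverNF-arity-of-joinable-instances [ id , σ ] [ id , σ' ] r r'

module SortPath (P : Spec) (d : ℕ) (s : ℕ → Spec.Const P)
  (steps : ∀ i → 1 ≤ i → i < suc d →
           ∃ λ s' → PTS.Inhabited P s' × Spec.Rule P s' (s i) (s (suc i))) where
  open PTS P

  climb : ∀ m {T k} → suc m ≤ suc d → [] ⊢ T ∶ const (s 1) → PiOverNF k T →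
          Σ Term λ T' → [] ⊢ T' ∶ const (s (suc m)) × PiOverNF (m + k) T'
  climb zero    _      ⊢T p = _ , ⊢T , p
  climb (suc m) m+2≤1+d ⊢T p =
    let T' , ⊢T' , p' = climb m (<⇒≤ m+2≤1+d) ⊢T p
        _ , (s'-sort , C , ⊢C) , r = steps (suc m) (s≤s z≤n) m+2≤1+d
    in Pi C (shift T') , prod (weak s'-sort ⊢T' ⊢C) ⊢C r , pi (PiOverNF-rename suc p')

  tower : s 1 ≡ s (suc d) → ∀ {T₀ k₀} → [] ⊢ T₀ ∶ const (s 1) → PiOverNF k₀ T₀ →
          ∀ j → Σ Term λ T → [] ⊢ T ∶ const (s 1) × PiOverNF (j * d + k₀) T
  tower _ ⊢T₀ p₀ zero = _ , ⊢T₀ , p₀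
  tower s₁≡sₙ {k₀ = k₀} ⊢T₀ p₀ (suc j) =
    let T , ⊢T , p = tower s₁≡sₙ ⊢T₀ p₀ j
        T' , ⊢T' , p' = climb d ≤-refl ⊢T p
    in T' , transport (λ t → [] ⊢ T' ∶ const t) (sym s₁≡sₙ) ⊢T' ,
       transport (λ k → PiOverNF k T') (sym (+-assoc d (j * d) k₀)) p'

theorem14 : (P : Spec) → let open Spec P in let open PTS P in
    (n : ℕ) → 1 < n → (s : ℕ → Const) →
    (∀ i → 1 ≤ i → i ≤ n → Sort (s i)) →
    s 1 ≡ s n → NFInhabited (s 1) →
    (∀ i → 1 ≤ i → i < n → ∃ λ s' → Inhabited s' × Rule s' (s i) (s (suc i))) →
    (∀ s₁' s₂' s₃' → Rule s₁' s₂' s₃' → ¬ Ax (s 1) s₂') →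
    (B : List Scheme) → ¬ Equivalent B
theorem14 P (suc (suc m)) (s≤s (s≤s z≤n)) s _ s₁≡sₙ (_ , A₀ , A₀-nf , ⊢A₀) steps not-axiom B equivalent =
  let i , j , i<j , same-scheme = pigeonhole (n<1+n (length B)) (proj₁ ∘ origin)
  in <⇒≢ (+-monoˡ-< (piArity A₀) (*-monoˡ-< (suc m) (s≤s i<j)))
         (same-scheme-same-arity {lookup B (proj₁ (origin j))}
           (transport (λ b → SubjectInstance (lookup B b) (level i)) same-scheme (proj₂ (origin i)))
           (proj₂ (origin j)) (arity i) (arity j))
  where
  open PTS P
  open Hilbert P
  open SortPath P (suc m) s steps

  tower-at : (j : Fin (suc (length B))) →
    Σ Term λ T → [] ⊢ T ∶ const (s 1) × PiOverNF (suc (toℕ j) * suc m + piArity A₀) T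
  tower-at j = tower s₁≡sₙ ⊢A₀ (nf A₀-nf) (suc (toℕ j))

  level : Fin (suc (length B)) → Term
  level j = proj₁ (tower-at j)

  arity : ∀ j → PiOverNF (suc (toℕ j) * suc m + piArity A₀) (level j)
  arity j = proj₂ (proj₂ (tower-at j))

  origin : ∀ j → Σ (Fin (length B)) λ b → SubjectInstance (lookup B b) (level j)
  origin j = scheme-of-product-type B equivalent not-axiom (proj₁ (proj₂ (tower-at j))) (arity j)
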